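{- If $G$ is an undirected path, cycle, or complete graph, then $G$ admits a rigid orientation. Therefore $D_{\min}(G)=D'_{\min}(G)=1$, $\chi_{D,\min}(G)=\chi(G)$ and $\chi'_{D,\min}(G)=\chi'(G)$.
   Context: An orientation of a simple graph assigns one direction to each edge. An automorphism of an oriented graph is a permutation $\phi$ of its vertices such that $\phi(u)\phi(v)$ is an arc whenever $uv$ is an arc; an oriented graph is rigid if its only automorphism is the identity. An $r$-vertex-labelling maps vertices to $\{1,\dots,r\}$, an $r$-arc-labelling maps arcs to $\{1,\dots,r\}$; colourings are proper labellings (adjacent vertices, resp. arcs sharing an end-vertex, get distinct labels). A labelling $\lambda$ is distinguishing if the only automorphism $\phi$ with $\lambda(\phi(u))=\lambda(u)$ for all vertices (resp. $\lambda(\phi(u)\phi(v))=\lambda(uv)$ for all arcs) is the identity. For an oriented graph $\vec G$, $D(\vec G)$, $\chi_D(\vec G)$, $D'(\vec G)$, $\chi'_D(\vec G)$ are the least $r$ for which $\vec G$ admits a distinguishing $r$-vertex-labelling, $r$-vertex-colouring, $r$-arc-labelling, $r$-arc-colouring. For an undirected graph $G$, $D_{\min}(G)$, $\chi_{D,\min}(G)$, $D'_{\min}(G)$, $\chi'_{D,\min}(G)$ are the minima of these respective parameters over all orientations of $G$. $\chi(G)$, $\chi'(G)$ are the chromatic number and chromatic index. -}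

module Defs where

open import Data.Nat using (ℕ; zero; suc; _≤_; _∸_; _≡ᵇ_)
open import Data.Bool using (Bool; true; false; T; _∨_; _∧_; not)
open import Data.Fin using (Fin; toℕ)
open import Data.Fin.Permutation using (Permutation′; _⟨$⟩ʳ_)
open import Data.Product using (Σ; _×_; _,_)
open import Data.Sum using (_⊎_)
open import Relation.Binary.PropositionalEquality using (_≡_; _≢_)
open import Relation.Nullary using (¬_)

-- Simple graphs and oriented graphs on the vertex set Fin n.
-- An (undirected) graph is a decidable adjacency relation; an oriented
-- graph is likewise given by its decidable arc relation.

Graph : ℕ → Set
Graph n = Fin n → Fin n → Bool

IsOrientation : ∀ {n} → Graph n → Graph n → Set
IsOrientation {n} G O =
  (∀ (u v : Fin n) → T (G u v) → T (O u v) ⊎ T (O v u)) ×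
  (∀ (u v : Fin n) → T (O u v) → T (G u v)) ×
  (∀ (u v : Fin n) → T (O u v) → ¬ T (O v u))

IsAutomorphism : ∀ {n} → Graph n → Permutation′ n → Set
IsAutomorphism {n} O φ =
  ∀ (u v : Fin n) → T (O u v) → T (O (φ ⟨$⟩ʳ u) (φ ⟨$⟩ʳ v))

IsIdentity : ∀ {n} → Permutation′ n → Set
IsIdentity {n} φ = ∀ (u : Fin n) → φ ⟨$⟩ʳ u ≡ u

Rigid : ∀ {n} → Graph n → Set
Rigid {n} O = ∀ (φ : Permutation′ n) → IsAutomorphism O φ → IsIdentity φ

-- Labellings. Labels {1,…,r} are represented by Fin r.

VertexLabelling : ℕ → ℕ → Set
VertexLabelling n r = Fin n → Fin r

ArcLabelling : ∀ {n} → Graph n → ℕ → Set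
ArcLabelling {n} O r = (u v : Fin n) → T (O u v) → Fin r

ProperVL : ∀ {n r} → Graph n → VertexLabelling n r → Set
ProperVL {n} O c = ∀ (u v : Fin n) → T (O u v) → c u ≢ c v

ProperAL : ∀ {n r} (O : Graph n) → ArcLabelling O r → Set
ProperAL {n} O c =
  ∀ (u v u' v' : Fin n) (a : T (O u v)) (a' : T (O u' v')) →
  (u ≡ u' ⊎ u ≡ v' ⊎ v ≡ u' ⊎ v ≡ v') →
  (u ≢ u' ⊎ v ≢ v') →
  c u v a ≢ c u' v' a'

DistinguishingVL : ∀ {n r} → Graph n → VertexLabelling n r → Set
DistinguishingVL {n} O c =
  ∀ (φ : Permutation′ n) → IsAutomorphism O φ →
  (∀ (u : Fin n) → c (φ ⟨$⟩ʳ u) ≡ c u) → IsIdentity φ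

DistinguishingAL : ∀ {n r} (O : Graph n) → ArcLabelling O r → Set
DistinguishingAL {n} O c =
  ∀ (φ : Permutation′ n) (aut : IsAutomorphism O φ) →
  (∀ (u v : Fin n) (a : T (O u v)) →
     c (φ ⟨$⟩ʳ u) (φ ⟨$⟩ʳ v) (aut u v a) ≡ c u v a) →
  IsIdentity φ

IsLeast : (ℕ → Set) → ℕ → Set
IsLeast P k = 1 ≤ k × P k × (∀ m → 1 ≤ m → P m → k ≤ m)

-- the four parameters of an oriented graph O, as relations "param O = k"
IsD : ∀ {n} → Graph n → ℕ → Set
IsD {n} O = IsLeast (λ r → Σ (VertexLabelling n r) λ c → DistinguishingVL O c)

IsChiD : ∀ {n} → Graph n → ℕ → Set
IsChiD {n} O = IsLeast (λ r → Σ (VertexLabelling n r) λ c →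
                                 ProperVL O c × DistinguishingVL O c)

IsD' : ∀ {n} → Graph n → ℕ → Set
IsD' {n} O = IsLeast (λ r → Σ (ArcLabelling O r) λ c → DistinguishingAL O c)

IsChiD' : ∀ {n} → Graph n → ℕ → Set
IsChiD' {n} O = IsLeast (λ r → Σ (ArcLabelling O r) λ c →
                                  ProperAL O c × DistinguishingAL O c)

IsMinOverOrientations : ∀ {n} → Graph n → (Graph n → ℕ → Set) → ℕ → Set
IsMinOverOrientations {n} G Param k =
  Σ (Graph n) (λ O → IsOrientation G O × Param O k) ×
  (∀ (O : Graph n) → IsOrientation G O → ∀ m → Param O m → k ≤ m)

IsDmin IsChiDmin IsD'min IsChiD'min : ∀ {n} → Graph n → ℕ → Set
IsDmin G = IsMinOverOrientations G IsD
IsChiDmin G = IsMinOverOrientations G IsChiD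
IsD'min G = IsMinOverOrientations G IsD'
IsChiD'min G = IsMinOverOrientations G IsChiD'

ProperColouring : ∀ {n r} → Graph n → (Fin n → Fin r) → Set
ProperColouring {n} G c = ∀ (u v : Fin n) → T (G u v) → c u ≢ c v

-- an edge labelling of G: label of edge {u,v}, independent of the order
EdgeLabelling : ∀ {n} → Graph n → ℕ → Set
EdgeLabelling {n} G r = (u v : Fin n) → T (G u v) → Fin r

IsEdgeLabelling : ∀ {n r} (G : Graph n) → EdgeLabelling G r → Set
IsEdgeLabelling {n} G c =
  ∀ (u v : Fin n) (e : T (G u v)) (e' : T (G v u)) → c u v e ≡ c v u e'

ProperEdgeColouring : ∀ {n r} (G : Graph n) → EdgeLabelling G r → Set
ProperEdgeColouring {n} G c =
  ∀ (u v w : Fin n) (e : T (G u v)) (e' : T (G u w)) →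
  v ≢ w → c u v e ≢ c u w e'

IsChromaticNumber : ∀ {n} → Graph n → ℕ → Set
IsChromaticNumber {n} G =
  IsLeast (λ r → Σ (Fin n → Fin r) λ c → ProperColouring G c)

IsChromaticIndex : ∀ {n} → Graph n → ℕ → Set
IsChromaticIndex {n} G =
  IsLeast (λ r → Σ (EdgeLabelling G r) λ c →
                   IsEdgeLabelling G c × ProperEdgeColouring G c)

PathG : ∀ n → Graph n
PathG n u v = (toℕ v ≡ᵇ suc (toℕ u)) ∨ (toℕ u ≡ᵇ suc (toℕ v))

CycleG : ∀ n → Graph n
CycleG n u v =
  PathG n u v ∨
  ((toℕ u ≡ᵇ n ∸ 1) ∧ (toℕ v ≡ᵇ 0)) ∨
  ((toℕ v ≡ᵇ n ∸ 1) ∧ (toℕ u ≡ᵇ 0))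

CompleteG : ∀ n → Graph n
CompleteG n u v = not (toℕ u ≡ᵇ toℕ v)

PathCycleOrComplete : ∀ n → Graph n → Set
PathCycleOrComplete n G =
  (1 ≤ n × (∀ u v → G u v ≡ PathG n u v)) ⊎
  (3 ≤ n × (∀ u v → G u v ≡ CycleG n u v)) ⊎
  (1 ≤ n × (∀ u v → G u v ≡ CompleteG n u v))

module Submission where

-- Each of P_n, C_n (n ≥ 3) and K_n is the symmetric closure of a relation A
-- on 0,…,n−1 whose arcs all go upward (u → v only if u < v) and which
-- contains the Hamiltonian path 0 → 1 → … → n−1: the successor arcs for P_n,
-- these plus the arc 0 → n−1 for C_n, and u → v for all u < v for K_n.
-- Such an A is an orientation of its symmetric closure, and it is rigid:
-- an automorphism maps the Hamiltonian path to a strictly increasing walk,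
-- and a self-map of Fin n increasing along consecutive elements is the
-- identity.
--
-- With a rigid orientation O of G at hand, the four parameters follow from
-- one principle (minimum-attained-at): the constant labelling distinguishes
-- O, so D_min = D'_min = 1; proper vertex/arc colourings of any orientation
-- are exactly proper vertex/edge colourings of G, so chi_D,min = chi and
-- chi'_D,min = chi', the minimum being attained at O.

open import Defs
open import Data.Nat using (ℕ; zero; suc; _≤_; _<_; _+_; _∸_; _≡ᵇ_; _<ᵇ_; z≤n; s≤s)
open import Data.Nat.Properties
open import Data.Bool using (true; false; T; _∨_; _∧_; not)
open import Data.Bool.Properties using (T-∨; T-∧; T-irrelevant; ∨-comm)
open import Data.Fin using (Fin; toℕ; fromℕ<)
open import Data.Fin.Properties using (toℕ-injective; toℕ<n; toℕ-fromℕ<)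
open import Data.Fin.Permutation using (_⟨$⟩ʳ_)
open import Data.Product using (Σ; _×_; _,_)
open import Data.Sum using (_⊎_; inj₁; inj₂; swap)
open import Data.Empty using (⊥; ⊥-elim)
open import Relation.Binary.PropositionalEquality
open import Function.Bundles using (Equivalence)
open Equivalence using (to; from)

element : ∀ {n k} → k < n → Σ (Fin n) (λ j → toℕ j ≡ k)
element k<n = fromℕ< k<n , toℕ-fromℕ< k<n

-- A self-map f of Fin n with f i < f (i+1) for all i is the identity:
-- counting from the bottom f i ≥ i, counting from the top f i ≤ i.
module IncreasingSelfMap {n : ℕ} (f : Fin n → Fin n)
         (increasing : ∀ i j → toℕ j ≡ suc (toℕ i) → toℕ (f i) < toℕ (f j)) where

  -- the k elements below i are mapped strictly below f i
  above : ∀ k (i : Fin n) → toℕ i ≡ k → k ≤ toℕ (f i)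
  above zero i _ = z≤n
  above (suc k) i i≡1+k with element (<-trans (n<1+n k) (subst (_< n) i≡1+k (toℕ<n i)))
  ... | j , j≡k = ≤-trans (s≤s (above k j j≡k))
                          (increasing j i (trans i≡1+k (cong suc (sym j≡k))))

  -- the k elements above i are mapped strictly above f i
  below : ∀ k (i : Fin n) → toℕ i + k < n → toℕ (f i) + k < n
  below zero i _ = subst (_< n) (sym (+-identityʳ _)) (toℕ<n (f i))
  below (suc k) i i+1+k<n = beyond (element (≤-<-trans (s≤s (m≤m+n (toℕ i) k)) 1+i+k<n))
    where
    open ≤-Reasoning
    1+i+k<n : suc (toℕ i) + k < n
    1+i+k<n = subst (_< n) (+-suc (toℕ i) k) i+1+k<n
    beyond : Σ (Fin n) (λ j → toℕ j ≡ suc (toℕ i)) → toℕ (f i) + suc k < n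
    beyond (j , j≡1+i) = begin-strict
      toℕ (f i) + suc k    ≡⟨ +-suc (toℕ (f i)) k ⟩
      suc (toℕ (f i)) + k  ≤⟨ +-monoˡ-≤ k (increasing i j j≡1+i) ⟩
      toℕ (f j) + k        <⟨ below k j (subst (λ x → x + k < n) (sym j≡1+i) 1+i+k<n) ⟩
      n                    ∎

  isIdentity : ∀ i → f i ≡ i
  isIdentity i = toℕ-injective (≤-antisym (m<1+n⇒m≤n fi<1+i) (above (toℕ i) i refl))
    where
    gap : ℕ
    gap = n ∸ suc (toℕ i)
    fits : suc (toℕ i) + gap ≡ n
    fits = m+[n∸m]≡n (toℕ<n i)
    fi<1+i : toℕ (f i) < suc (toℕ i)
    fi<1+i = +-cancelʳ-< gap (toℕ (f i)) (suc (toℕ i))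
               (subst (toℕ (f i) + gap <_) (sym fits) (below gap i (≤-reflexive fits)))

Upward : ∀ {n} → Graph n → Set
Upward {n} A = ∀ (u v : Fin n) → T (A u v) → toℕ u < toℕ v

ContainsPath : ∀ {n} → Graph n → Set
ContainsPath {n} A = ∀ (u v : Fin n) → toℕ v ≡ suc (toℕ u) → T (A u v)

SymClosure : ∀ {n} → Graph n → Graph n
SymClosure A u v = A u v ∨ A v u

Undirected : ∀ {n} → Graph n → Set
Undirected {n} G = ∀ (u v : Fin n) → T (G u v) → T (G v u)

symClosure-undirected : ∀ {n} (A : Graph n) → Undirected (SymClosure A)
symClosure-undirected A u v e = from (T-∨ {A v u}) (swap (to (T-∨ {A u v}) e))

upward-orientation : ∀ {n} {A : Graph n} → Upward A → IsOrientation (SymClosure A) A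
upward-orientation {A = A} up =
  (λ u v e → to T-∨ e) ,
  (λ u v a → from (T-∨ {y = A v u}) (inj₁ a)) ,
  λ u v a a' → <-asym (up u v a) (up v u a')

-- an automorphism of an upward relation containing the Hamiltonian path maps
-- that path to a strictly increasing walk, hence fixes every vertex
upward-rigid : ∀ {n} {A : Graph n} → Upward A → ContainsPath A → Rigid A
upward-rigid up path φ aut =
  IncreasingSelfMap.isIdentity (φ ⟨$⟩ʳ_) (λ i j j≡1+i → up _ _ (aut i j (path i j j≡1+i)))

UpwardPathClosure : ∀ n → Graph n → Set
UpwardPathClosure n G =
  Σ (Graph n) λ A → Upward A × ContainsPath A × (∀ u v → G u v ≡ SymClosure A u v)

orientation-resp : ∀ {n} {G H O : Graph n} → (∀ u v → G u v ≡ H u v) →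
                   IsOrientation H O → IsOrientation G O
orientation-resp G≡H (cover , sub , anti) =
  (λ u v e → cover u v (subst T (G≡H u v) e)) ,
  (λ u v a → subst T (sym (G≡H u v)) (sub u v a)) , anti

undirected-resp : ∀ {n} {G H : Graph n} → (∀ u v → G u v ≡ H u v) → Undirected H → Undirected G
undirected-resp G≡H undirected u v e =
  subst T (sym (G≡H v u)) (undirected u v (subst T (G≡H u v) e))

rigid-orientation : ∀ {n} {G : Graph n} → UpwardPathClosure n G →
                    Undirected G × Σ (Graph n) (λ O → IsOrientation G O × Rigid O)
rigid-orientation (A , up , path , G≡) =
  undirected-resp G≡ (symClosure-undirected A) ,
  A , orientation-resp G≡ (upward-orientation up) , upward-rigid up path

least-transfer : ∀ {P Q : ℕ → Set} {k} → IsLeast Q k →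
                 (∀ r → Q r → P r) → (∀ r → 1 ≤ r → P r → Q r) → IsLeast P k
least-transfer (1≤k , Qk , least) Q⇒P P⇒Q =
  1≤k , Q⇒P _ Qk , λ m 1≤m Pm → least m 1≤m (P⇒Q m 1≤m Pm)

minimum-attained-at : ∀ {n} {G : Graph n} (O : Graph n) (P : Graph n → ℕ → Set)
  {Q : ℕ → Set} {k} → IsOrientation G O →
  (∀ r → Q r → P O r) →
  (∀ O' → IsOrientation G O' → ∀ r → 1 ≤ r → P O' r → Q r) →
  IsLeast Q k → IsMinOverOrientations G (λ O' → IsLeast (P O')) k
minimum-attained-at O P orient complete sound leastQ@(_ , _ , least) =
  (O , orient , least-transfer leastQ complete (sound O orient)) ,
  λ O' orient' m (1≤m , Pm , _) → least m 1≤m (sound O' orient' m 1≤m Pm)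

one-least : IsLeast (1 ≤_) 1
one-least = s≤s z≤n , s≤s z≤n , λ _ 1≤m _ → 1≤m

arc-of-edge : ∀ {n} {G O : Graph n} → IsOrientation G O →
              ∀ u v → T (G u v) → T (O u v) ⊎ T (O v u)
arc-of-edge (cover , _ , _) = cover

edge-of-arc : ∀ {n} {G O : Graph n} → IsOrientation G O → ∀ u v → T (O u v) → T (G u v)
edge-of-arc (_ , sub , _) = sub

antisymmetric : ∀ {n} {G O : Graph n} → IsOrientation G O → ∀ u v → T (O u v) → T (O v u) → ⊥
antisymmetric (_ , _ , anti) = anti

arc-ends-differ : ∀ {n} {G O : Graph n} → IsOrientation G O → ∀ u v → T (O u v) → u ≢ v
arc-ends-differ orient u .u a refl = antisymmetric orient u u a a

proper-of-orientation : ∀ {n r} {G O : Graph n} → IsOrientation G O →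
                        (c : Fin n → Fin r) → ProperVL O c → ProperColouring G c
proper-of-orientation orient c proper u v e with arc-of-edge orient u v e
... | inj₁ a = proper u v a
... | inj₂ a = λ cu≡cv → proper v u a (sym cu≡cv)

proper-for-orientation : ∀ {n r} {G O : Graph n} → IsOrientation G O →
                         (c : Fin n → Fin r) → ProperColouring G c → ProperVL O c
proper-for-orientation orient c proper u v a = proper u v (edge-of-arc orient u v a)

module EdgesFromArcs {n r} {G O : Graph n} (orient : IsOrientation G O)
                     (c : ArcLabelling O r) (proper : ProperAL O c) where

  arcColour : ∀ u v → T (O u v) ⊎ T (O v u) → Fin r
  arcColour u v (inj₁ a) = c u v a
  arcColour u v (inj₂ a) = c v u a

  edgeColour : EdgeLabelling G r
  edgeColour u v e = arcColour u v (arc-of-edge orient u v e)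

  isEdgeLabelling : IsEdgeLabelling G edgeColour
  isEdgeLabelling u v e e' with arc-of-edge orient u v e | arc-of-edge orient v u e'
  ... | inj₁ a | inj₁ a' = ⊥-elim (antisymmetric orient u v a a')
  ... | inj₁ a | inj₂ a' = cong (c u v) (T-irrelevant a a')
  ... | inj₂ a | inj₁ a' = cong (c v u) (T-irrelevant a a')
  ... | inj₂ a | inj₂ a' = ⊥-elim (antisymmetric orient v u a a')

  -- the arcs of two distinct edges at u share the end u and are distinct arcs
  isProper : ProperEdgeColouring G edgeColour
  isProper u v w e e' v≢w with arc-of-edge orient u v e | arc-of-edge orient u w e'
  ... | inj₁ a | inj₁ a' = proper u v u w a a' (inj₁ refl) (inj₂ v≢w)
  ... | inj₁ a | inj₂ a' = proper u v w u a a' (inj₂ (inj₁ refl))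
                                  (inj₂ (λ v≡u → arc-ends-differ orient u v a (sym v≡u)))
  ... | inj₂ a | inj₁ a' = proper v u u w a a' (inj₂ (inj₂ (inj₁ refl)))
                                  (inj₁ (arc-ends-differ orient v u a))
  ... | inj₂ a | inj₂ a' = proper v u w u a a' (inj₂ (inj₂ (inj₂ refl))) (inj₁ v≢w)

module ArcsFromEdges {n r} {G O : Graph n} (undirected : Undirected G)
                     (orient : IsOrientation G O) (c : EdgeLabelling G r)
                     (isLabelling : IsEdgeLabelling G c) (proper : ProperEdgeColouring G c) where

  edgeOf : ∀ u v → T (O u v) → T (G u v)
  edgeOf = edge-of-arc orient

  arcColour : ArcLabelling O r
  arcColour u v a = c u v (edgeOf u v a)

  from-head : ∀ u v (a : T (O u v)) → arcColour u v a ≡ c v u (undirected u v (edgeOf u v a))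
  from-head u v a = isLabelling u v (edgeOf u v a) (undirected u v (edgeOf u v a))

  not-reverse : ∀ {u v x y} → T (O u v) → T (O x y) → x ≡ v → y ≡ u → ⊥
  not-reverse {u} {v} a a' refl refl = antisymmetric orient u v a a'

  -- in each case, read both colours at the shared end, where they are
  -- colours of two distinct edges
  isProper : ProperAL O arcColour
  isProper u v .u v' a a' (inj₁ refl) (inj₁ u≢u) = ⊥-elim (u≢u refl)
  isProper u v .u v' a a' (inj₁ refl) (inj₂ v≢v') = proper u v v' _ _ v≢v'
  isProper u v u' .u a a' (inj₂ (inj₁ refl)) _ = λ same →
    proper u v u' _ _ (λ v≡u' → not-reverse a a' (sym v≡u') refl) (trans same (from-head u' u a'))
  isProper u v .v v' a a' (inj₂ (inj₂ (inj₁ refl))) _ = λ same →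
    proper v u v' _ _ (λ u≡v' → not-reverse a a' refl (sym u≡v'))
      (trans (sym (from-head u v a)) same)
  isProper u v u' .v a a' (inj₂ (inj₂ (inj₂ refl))) (inj₂ v≢v) = ⊥-elim (v≢v refl)
  isProper u v u' .v a a' (inj₂ (inj₂ (inj₂ refl))) (inj₁ u≢u') = λ same →
    proper v u u' _ _ u≢u' (trans (sym (from-head u v a)) (trans same (from-head u' v a')))

module RigidlyOrientable {n} {G : Graph n} (undirected : Undirected G) (O : Graph n)
                         (orient : IsOrientation G O) (rigid : Rigid O) where

  Dmin : IsDmin G 1
  Dmin = minimum-attained-at O (λ O' r → Σ (VertexLabelling n r) λ c → DistinguishingVL O' c)
           orient constant (λ _ _ r 1≤r _ → 1≤r) one-least
    where
    constant : ∀ r → 1 ≤ r → Σ (VertexLabelling n r) λ c → DistinguishingVL O c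
    constant (suc r) _ = (λ _ → Data.Fin.zero) , λ φ aut _ → rigid φ aut

  D'min : IsD'min G 1
  D'min = minimum-attained-at O (λ O' r → Σ (ArcLabelling O' r) λ c → DistinguishingAL O' c)
            orient constant (λ _ _ r 1≤r _ → 1≤r) one-least
    where
    constant : ∀ r → 1 ≤ r → Σ (ArcLabelling O r) λ c → DistinguishingAL O c
    constant (suc r) _ = (λ _ _ _ → Data.Fin.zero) , λ φ aut _ → rigid φ aut

  chiDmin : ∀ k → IsChromaticNumber G k → IsChiDmin G k
  chiDmin k chromatic =
    minimum-attained-at O
      (λ O' r → Σ (VertexLabelling n r) λ c → ProperVL O' c × DistinguishingVL O' c) orient
      (λ r (c , proper) → c , proper-for-orientation orient c proper , λ φ aut _ → rigid φ aut)
      (λ O' orient' r _ (c , proper , _) → c , proper-of-orientation orient' c proper)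
      chromatic

  chiD'min : ∀ k → IsChromaticIndex G k → IsChiD'min G k
  chiD'min k chromatic =
    minimum-attained-at O
      (λ O' r → Σ (ArcLabelling O' r) λ c → ProperAL O' c × DistinguishingAL O' c) orient
      (λ r (c , isLabelling , proper) →
         let open ArcsFromEdges undirected orient c isLabelling proper
         in arcColour , isProper , λ φ aut _ → rigid φ aut)
      (λ O' orient' r _ (c , proper , _) →
         let open EdgesFromArcs orient' c proper
         in edgeColour , isEdgeLabelling , isProper)
      chromatic

interchange : ∀ a b c d → (a ∨ b) ∨ (d ∨ c) ≡ (a ∨ c) ∨ (b ∨ d)
interchange true  b     c     d = refl
interchange false true  true  d = refl
interchange false true  false d = refl
interchange false false c     d = ∨-comm d c

distinct-comparable : ∀ m k → not (m ≡ᵇ k) ≡ (m <ᵇ k) ∨ (k <ᵇ m)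
distinct-comparable zero    zero    = refl
distinct-comparable zero    (suc k) = refl
distinct-comparable (suc m) zero    = refl
distinct-comparable (suc m) (suc k) = distinct-comparable m k

closure-resp : ∀ {n} {G H : Graph n} → (∀ u v → G u v ≡ H u v) →
               UpwardPathClosure n H → UpwardPathClosure n G
closure-resp G≡H (A , up , path , H≡) = A , up , path , λ u v → trans (G≡H u v) (H≡ u v)

pathArc : ∀ n → Graph n
pathArc n u v = toℕ v ≡ᵇ suc (toℕ u)

pathArc-upward : ∀ {n} → Upward (pathArc n)
pathArc-upward u v a = ≤-reflexive (sym (≡ᵇ⇒≡ _ _ a))

path-closure : ∀ n → UpwardPathClosure n (PathG n)
path-closure n = pathArc n , pathArc-upward , (λ u v → ≡⇒≡ᵇ _ _) , λ u v → refl

wrapArc cycleArc : ∀ n → Graph n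
wrapArc n u v = (toℕ v ≡ᵇ n ∸ 1) ∧ (toℕ u ≡ᵇ 0)
cycleArc n u v = pathArc n u v ∨ wrapArc n u v

cycleArc-upward : ∀ {n} → 2 ≤ n → Upward (cycleArc n)
cycleArc-upward {n} 2≤n u v a with to (T-∨ {pathArc n u v}) a
... | inj₁ p = pathArc-upward u v p
... | inj₂ w with to (T-∧ {toℕ v ≡ᵇ n ∸ 1}) w
... | v≡n-1 , u≡0 = subst₂ _<_ (sym (≡ᵇ⇒≡ _ _ u≡0)) (sym (≡ᵇ⇒≡ _ _ v≡n-1)) (m<n⇒0<n∸m 2≤n)

cycle-closure : ∀ n → 3 ≤ n → UpwardPathClosure n (CycleG n)
cycle-closure n 3≤n =
  cycleArc n , cycleArc-upward (≤-trans (n≤1+n 2) 3≤n) ,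
  (λ u v v≡1+u → from (T-∨ {y = wrapArc n u v}) (inj₁ (≡⇒≡ᵇ _ _ v≡1+u))) ,
  λ u v → interchange (pathArc n u v) (pathArc n v u) (wrapArc n u v) (wrapArc n v u)

completeArc : ∀ n → Graph n
completeArc n u v = toℕ u <ᵇ toℕ v

complete-closure : ∀ n → UpwardPathClosure n (CompleteG n)
complete-closure n =
  completeArc n , (λ u v → <ᵇ⇒< _ _) ,
  (λ u v v≡1+u → <⇒<ᵇ (subst (toℕ u <_) (sym v≡1+u) (n<1+n _))) ,
  λ u v → distinct-comparable (toℕ u) (toℕ v)

upward-path-closure : ∀ n (G : Graph n) → PathCycleOrComplete n G → UpwardPathClosure n G
upward-path-closure n G (inj₁ (_ , G≡P))         = closure-resp G≡P (path-closure n)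
upward-path-closure n G (inj₂ (inj₁ (3≤n , G≡C))) = closure-resp G≡C (cycle-closure n 3≤n)
upward-path-closure n G (inj₂ (inj₂ (_ , G≡K)))  = closure-resp G≡K (complete-closure n)

theorem5 : (n : ℕ) (G : Graph n) → PathCycleOrComplete n G →
    Σ (Graph n) (λ O → IsOrientation G O × Rigid O) ×
    IsDmin G 1 × IsD'min G 1 ×
    (∀ k → IsChromaticNumber G k → IsChiDmin G k) ×
    (∀ k → IsChromaticIndex G k → IsChiD'min G k)
theorem5 n G shape with rigid-orientation (upward-path-closure n G shape)
... | undirected , O , orient , rigid = (O , orient , rigid) , Dmin , D'min , chiDmin , chiD'min
  where open RigidlyOrientable undirected O orient rigid
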